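{- Let $(P,\leq,{}',0,1)$ be an orthogonal lub-complete poset and $x,y,z\in P$. Then: (i) $x'\leq u$ for every $u\in x\rightarrow_S y$; (ii) if $x\leq y$ then $z\rightarrow_S x\leq_1 z\rightarrow_S y$; (iii) if $x\leq y$ then $x\rightarrow_S y=\{x\vee x'\}$; if $x'\perp y'$ then $x\rightarrow_S y=\{x'\vee(x\wedge y)\}$; if $y\leq x$ then $x\rightarrow_S y=\{x'\vee y\}=x\rightarrow_D y$; (iv) $x\rightarrow_S 1=\{x\vee x'\}$ and $1\rightarrow_S x=\{x\}$; (v) $x\rightarrow_S 0=\{x'\}$ and $0\rightarrow_S x=\{1\}$.
   Context: For a poset $(P,\leq)$ and $A\subseteq P$: $L(A)=\{x: x\leq a\ \forall a\in A\}$, $L(x,y)=L(\{x,y\})$; $\operatorname{Max}A$: maximal elements of $A$. For $A,B\subseteq P$: $A\leq_1 B$ iff for every $x\in A$ there is $y\in B$ with $x\leq y$. A bounded poset $(P,\leq,{}',0,1)$ with antitone involution: $x\leq y\Rightarrow y'\leq x'$, $x''=x$. $x\perp y$ iff $x\leq y'$. Orthogonal: $x\perp y$ implies the supremum $x\vee y$ exists. Lub-complete: for every finite $M\subseteq P$ and lower bound $x$ of $M$ there is a maximal element of $L(M)$ above $x$. Sasaki implication: $x\rightarrow_S y=\{x'\vee a: a\in\operatorname{Max}L(x,y)\}$; Dishkant implication: $x\rightarrow_D y=y'\rightarrow_S x'=\{y\vee b: b\in\operatorname{Max}L(x',y')\}$. -}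

module Defs where

open import Level using (Level; _⊔_) renaming (suc to lsuc)
open import Data.Product using (Σ; ∃; _×_; _,_)
open import Data.List using (List; []; _∷_)
open import Data.List.Relation.Unary.All using (All)
open import Relation.Binary.PropositionalEquality using (_≡_)
open import Relation.Binary.Structures using (IsPartialOrder)
open import Relation.Unary using (Pred; _∈_)

record BPAI (c ℓ : Level) : Set (lsuc (c ⊔ ℓ)) where
  infix 4 _≤_
  infix 8 _′
  field
    Carrier        : Set c
    _≤_            : Carrier → Carrier → Set ℓ
    isPartialOrder : IsPartialOrder _≡_ _≤_
    _′             : Carrier → Carrier
    0#             : Carrier
    1#             : Carrier
    bottom         : ∀ x → 0# ≤ x
    top            : ∀ x → x ≤ 1#
    antitone       : ∀ {x y} → x ≤ y → y ′ ≤ x ′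
    involutive     : ∀ x → x ′ ′ ≡ x

module Ops {c ℓ : Level} (P : BPAI c ℓ) where
  open BPAI P public

  infix 4 _⊥_
  _⊥_ : Carrier → Carrier → Set ℓ
  x ⊥ y = x ≤ y ′

  IsSup : Carrier → Carrier → Carrier → Set (c ⊔ ℓ)
  IsSup x y s = (x ≤ s × y ≤ s) × (∀ u → x ≤ u → y ≤ u → s ≤ u)

  IsInf : Carrier → Carrier → Carrier → Set (c ⊔ ℓ)
  IsInf x y m = (m ≤ x × m ≤ y) × (∀ u → u ≤ x → u ≤ y → u ≤ m)

  L : List Carrier → Pred Carrier (c ⊔ ℓ)
  L M z = All (z ≤_) M

  L₂ : Carrier → Carrier → Pred Carrier (c ⊔ ℓ)
  L₂ x y = L (x ∷ y ∷ [])

  Max : ∀ {a} → Pred Carrier a → Pred Carrier (c ⊔ ℓ ⊔ a)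
  Max A z = z ∈ A × (∀ w → w ∈ A → z ≤ w → w ≡ z)

  _≤₁_ : ∀ {a b} → Pred Carrier a → Pred Carrier b → Set (c ⊔ ℓ ⊔ a ⊔ b)
  A ≤₁ B = ∀ x → x ∈ A → ∃ λ y → y ∈ B × x ≤ y

  Orthogonal : Set (c ⊔ ℓ)
  Orthogonal = ∀ x y → x ⊥ y → ∃ λ s → IsSup x y s

  LubComplete : Set (c ⊔ ℓ)
  LubComplete = ∀ (M : List Carrier) x → x ∈ L M →
                ∃ λ m → m ∈ Max (L M) × x ≤ m

  -- Sasaki implication  x →S y = { x′ ∨ a : a ∈ Max L(x,y) }
  -- (u belongs to it iff u = x′ ∨ a for some a ∈ Max L(x,y))
  _→S_ : Carrier → Carrier → Pred Carrier (c ⊔ ℓ)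
  (x →S y) u = ∃ λ a → a ∈ Max (L₂ x y) × IsSup (x ′) a u

  _→D_ : Carrier → Carrier → Pred Carrier (c ⊔ ℓ)
  x →D y = (y ′) →S (x ′)

module Submission where

open import Defs
open import Data.Product using (∃; _×_; _,_; proj₁; proj₂)
open import Data.List using ([]; _∷_)
open import Data.List.Relation.Unary.All using ([]; _∷_)
open import Relation.Binary.PropositionalEquality using (_≡_; refl; sym; subst)
open import Relation.Binary.Structures using (IsPartialOrder)
open import Relation.Unary using (_∈_; _≐_; ｛_｝)
open import Relation.Unary.Properties using (≐-sym; ≐-trans)

-- Whenever the meet m = x ∧ y exists, it is the only maximal lower bound
-- of x and y, so x →S y collapses to the single element x′ ∨ m.  Every
-- case of the proposition exhibits such a meet: x or y when they are
-- comparable, and (x′ ∨ y′)′ by De Morgan when x′ ⊥ y′.  Orthogonality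
-- supplies the join x′ ∨ m because m ≤ x means m ⊥ x′.

module Properties {c ℓ} (P : BPAI c ℓ) where
  open Ops P
  open IsPartialOrder isPartialOrder
    using (antisym) renaming (refl to ≤-refl; trans to ≤-trans)

  IsSup-unique : ∀ {a b s t} → IsSup a b s → IsSup a b t → s ≡ t
  IsSup-unique ((a≤s , b≤s) , s-least) ((a≤t , b≤t) , t-least) =
    antisym (s-least _ a≤t b≤t) (t-least _ a≤s b≤s)

  IsSup-comm : ∀ {a b s} → IsSup a b s → IsSup b a s
  IsSup-comm ((a≤s , b≤s) , s-least) = (b≤s , a≤s) , λ u b≤u a≤u → s-least u a≤u b≤u

  ≤⇒IsSup : ∀ {a b} → a ≤ b → IsSup a b b
  ≤⇒IsSup a≤b = (a≤b , ≤-refl) , λ _ _ b≤u → b≤u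

  ≥⇒IsSup : ∀ {a b} → b ≤ a → IsSup a b a
  ≥⇒IsSup b≤a = IsSup-comm (≤⇒IsSup b≤a)

  ≤⇒IsInf : ∀ {a b} → a ≤ b → IsInf a b a
  ≤⇒IsInf a≤b = (≤-refl , a≤b) , λ _ u≤a _ → u≤a

  ≥⇒IsInf : ∀ {a b} → b ≤ a → IsInf a b b
  ≥⇒IsInf b≤a = (b≤a , ≤-refl) , λ _ _ u≤b → u≤b

  IsInf⇒Max : ∀ {x y m} → IsInf x y m → m ∈ Max (L₂ x y)
  IsInf⇒Max ((m≤x , m≤y) , m-greatest) =
    (m≤x ∷ m≤y ∷ []) ,
    λ { w (w≤x ∷ w≤y ∷ []) m≤w → antisym (m-greatest w w≤x w≤y) m≤w }

  ≤′⇒≤′ : ∀ {a b} → a ≤ b ′ → b ≤ a ′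
  ≤′⇒≤′ {a} {b} a≤b′ = subst (_≤ a ′) (involutive b) (antitone a≤b′)

  ′≤⇒′≤ : ∀ {a b} → a ′ ≤ b → b ′ ≤ a
  ′≤⇒′≤ {a} {b} a′≤b = subst (b ′ ≤_) (involutive a) (antitone a′≤b)

  1′≡0 : 1# ′ ≡ 0#
  1′≡0 = antisym (′≤⇒′≤ (top (0# ′))) (bottom (1# ′))

  0′≡1 : 0# ′ ≡ 1#
  0′≡1 = antisym (top (0# ′)) (≤′⇒≤′ (bottom (1# ′)))

  IsSup′⇒IsInf : ∀ {x y t} → IsSup (x ′) (y ′) t → IsInf x y (t ′)
  IsSup′⇒IsInf ((x′≤t , y′≤t) , t-least) =
    (′≤⇒′≤ x′≤t , ′≤⇒′≤ y′≤t) ,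
    λ u u≤x u≤y → ≤′⇒≤′ (t-least (u ′) (antitone u≤x) (antitone u≤y))

  orthogonal-IsSup′ : Orthogonal → ∀ {x m} → m ≤ x → ∃ λ s → IsSup (x ′) m s
  orthogonal-IsSup′ orth {x} {m} m≤x = orth (x ′) m (antitone m≤x)

  →S-lowerBound : ∀ {x y u} → u ∈ (x →S y) → x ′ ≤ u
  →S-lowerBound (_ , _ , (x′≤u , _) , _) = x′≤u

  →S-IsInf : ∀ {x y m s} → IsInf x y m → IsSup (x ′) m s → (x →S y) ≐ ｛ s ｝
  →S-IsInf {x} {y} {m} {s} m-inf s-sup = ⊆｛s｝ , λ { refl → m , IsInf⇒Max m-inf , s-sup }
    where
    ⊆｛s｝ : ∀ {u} → u ∈ (x →S y) → s ≡ u
    ⊆｛s｝ (a , ((a≤x ∷ a≤y ∷ []) , a-maximal) , u-sup)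
      with refl ← a-maximal m (proj₁ (IsInf⇒Max m-inf)) (proj₂ m-inf a a≤x a≤y)
      = IsSup-unique s-sup u-sup

  -- Lub-completeness enlarges a ∈ Max L(z,x) to some b ∈ Max L(z,y), and z′ ∨ a ≤ z′ ∨ b.
  →S-monoʳ : Orthogonal → LubComplete → ∀ {x y z} → x ≤ y → (z →S x) ≤₁ (z →S y)
  →S-monoʳ orth lub {x} {y} {z} x≤y u (a , ((a≤z ∷ a≤x ∷ []) , _) , _ , u-least)
    with lub (z ∷ y ∷ []) a (a≤z ∷ ≤-trans a≤x x≤y ∷ [])
  ... | b , b-max@((b≤z ∷ _) , _) , a≤b
    with orthogonal-IsSup′ orth b≤z
  ... | s , s-sup@((z′≤s , b≤s) , _) =
    s , (b , b-max , s-sup) , u-least s z′≤s (≤-trans a≤b b≤s)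

  →S-≤ : Orthogonal → ∀ {x y} → x ≤ y → ∃ λ s → IsSup x (x ′) s × (x →S y) ≐ ｛ s ｝
  →S-≤ orth {x} x≤y with orthogonal-IsSup′ orth (≤-refl {x})
  ... | s , s-sup = s , IsSup-comm s-sup , →S-IsInf (≤⇒IsInf x≤y) s-sup

  →S-⊥ : Orthogonal → ∀ {x y} → x ′ ⊥ y ′ →
         ∃ λ m → ∃ λ s → IsInf x y m × IsSup (x ′) m s × (x →S y) ≐ ｛ s ｝
  →S-⊥ orth {x} {y} x′⊥y′ with orth (x ′) (y ′) x′⊥y′
  ... | t , t-sup with IsSup′⇒IsInf t-sup
  ... | m-inf@((m≤x , _) , _) with orthogonal-IsSup′ orth m≤x
  ... | s , s-sup = t ′ , s , m-inf , s-sup , →S-IsInf m-inf s-sup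

  →S-≥ : Orthogonal → ∀ {x y} → y ≤ x →
         ∃ λ s → IsSup (x ′) y s × (x →S y) ≐ ｛ s ｝ × (x →S y) ≐ (x →D y)
  →S-≥ orth {x} {y} y≤x with orthogonal-IsSup′ orth y≤x
  ... | s , s-sup = s , s-sup , →S≐s , ≐-trans →S≐s (≐-sym →D≐s)
    where
    →S≐s : (x →S y) ≐ ｛ s ｝
    →S≐s = →S-IsInf (≥⇒IsInf y≤x) s-sup

    →D≐s : (x →D y) ≐ ｛ s ｝
    →D≐s = →S-IsInf (≥⇒IsInf (antitone y≤x))
                    (subst (λ w → IsSup w (x ′) s) (sym (involutive y)) (IsSup-comm s-sup))

proposition6 : ∀ {c ℓ} (P : BPAI c ℓ) → let open Ops P in
    Orthogonal → LubComplete → ∀ x y z →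
      (∀ u → u ∈ (x →S y) → x ′ ≤ u)
      × (x ≤ y → (z →S x) ≤₁ (z →S y))
      × (x ≤ y → ∃ λ s → IsSup x (x ′) s × (x →S y) ≐ ｛ s ｝)
      × (x ′ ⊥ y ′ → ∃ λ m → ∃ λ s → IsInf x y m × IsSup (x ′) m s × (x →S y) ≐ ｛ s ｝)
      × (y ≤ x → ∃ λ s → IsSup (x ′) y s × (x →S y) ≐ ｛ s ｝ × (x →S y) ≐ (x →D y))
      × (∃ λ s → IsSup x (x ′) s × (x →S 1#) ≐ ｛ s ｝)
      × ((1# →S x) ≐ ｛ x ｝)
      × ((x →S 0#) ≐ ｛ x ′ ｝)
      × ((0# →S x) ≐ ｛ 1# ｝)
proposition6 P orth lub x y z =
    (λ _ → →S-lowerBound)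
  , →S-monoʳ orth lub
  , →S-≤ orth
  , →S-⊥ orth
  , →S-≥ orth
  , →S-≤ orth (top x)
  , →S-IsInf (≥⇒IsInf (top x)) (≤⇒IsSup (subst (_≤ x) (sym 1′≡0) (bottom x)))
  , →S-IsInf (≥⇒IsInf (bottom x)) (≥⇒IsSup (bottom (x ′)))
  , →S-IsInf (≤⇒IsInf (bottom x))
              (subst (λ t → IsSup (0# ′) 0# t) 0′≡1 (≥⇒IsSup (bottom (0# ′))))
  where
  open Ops P
  open Properties P
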